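{- Let $G$ be a $d$-regular bipartite graph on $2n$ vertices and apply the following procedure: set $H_1:=G$, $i:=1$; (1) find a smallest (by number of vertices) nonempty proper subset $X_i\subset V(H_i)$ with $|\delta_{H_i}(X_i)|<d/4$; if none exists, let $G_i:=H_i$ and stop; (2) otherwise let $G_i$ be the subgraph of $H_i$ induced by $X_i$ and let $H_{i+1}$ be $H_i$ with the vertices of $X_i$ removed; (3) increment $i$ and return to (1). Then the number of steps $k$ of the procedure satisfies $k\le 4n/d$, and at most $n$ edges are removed in the process (i.e. at most $n$ edges of $G$ join different graphs $G_i$).
   Context: $\delta_H(X)$ denotes the set of edges of $H$ with exactly one endpoint in $X$. -}

module Defs where

open import Data.Nat using (ℕ; zero; suc; _+_; _*_; _∸_; _<_; _≤_; _≤ᵇ_; _≡ᵇ_; _<ᵇ_)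
open import Data.Fin using (Fin; zero; suc)
open import Data.Bool using (Bool; true; false; _∧_; not; if_then_else_)
open import Data.Product using (Σ; ∃; _×_; _,_)
open import Relation.Binary.PropositionalEquality using (_≡_; _≢_)
open import Relation.Nullary using (¬_)

sumF : ∀ {m} → (Fin m → ℕ) → ℕ
sumF {zero}  f = 0
sumF {suc m} f = f zero + sumF (λ i → f (suc i))

countF : ∀ {m} → (Fin m → Bool) → ℕ
countF f = sumF (λ i → if f i then 1 else 0)

record Graph (m : ℕ) : Set where
  field
    adj     : Fin m → Fin m → Bool
    sym     : ∀ u v → adj u v ≡ adj v u
    irrefl  : ∀ v → adj v v ≡ false
open Graph public

VSet : ℕ → Set
VSet m = Fin m → Bool

degree : ∀ {m} → Graph m → Fin m → ℕ
degree G v = countF (adj G v)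

Regular : ∀ {m} → Graph m → ℕ → Set
Regular G d = ∀ v → degree G v ≡ d

Bipartite : ∀ {m} → Graph m → Set
Bipartite {m} G = Σ (Fin m → Bool) λ c → ∀ u v → adj G u v ≡ true → c u ≢ c v

_⊆V_ : ∀ {m} → VSet m → VSet m → Set
Y ⊆V H = ∀ v → Y v ≡ true → H v ≡ true

NonemptyProper : ∀ {m} → VSet m → VSet m → Set
NonemptyProper {m} H Y =
  (Y ⊆V H) × (∃ λ (v : Fin m) → Y v ≡ true) × (∃ λ (v : Fin m) → H v ≡ true × Y v ≡ false)

-- |δ_H(X)| : number of edges of the induced subgraph G[H] with exactly one endpoint in X
-- (for X ⊆ H; each such edge counted once, via its endpoint in X).
cut : ∀ {m} → Graph m → VSet m → VSet m → ℕ
cut G H X = sumF λ u → countF λ v → X u ∧ H v ∧ not (X v) ∧ adj G u v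

SmallCut : ∀ {m} → Graph m → ℕ → VSet m → VSet m → Set
SmallCut G d H X = NonemptyProper H X × (4 * cut G H X < d)

-- A run of the procedure with k steps, encoded by the step index part v ∈ {0,…,k-1}
-- of the graph G_{(part v)+1} containing v.  With 0-based index i:
--   V(H_{i+1}) = { v | i ≤ part v },  X_{i+1} = { v | part v = i }  (for i < k-1),
--   G_k = H_k = { v | k-1 ≤ part v }.
record Run {m : ℕ} (G : Graph m) (d : ℕ) : Set where
  field
    k      : ℕ
    k≥1    : 1 ≤ k
    part   : Fin m → ℕ
    part<k : ∀ v → part v < k
  Hs : ℕ → VSet m
  Hs i v = i ≤ᵇ part v
  Xs : ℕ → VSet m
  Xs i v = part v ≡ᵇ i
  field
    step-small : ∀ i → suc i < k → SmallCut G d (Hs i) (Xs i)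
    step-min   : ∀ i → suc i < k → ∀ Y → SmallCut G d (Hs i) Y → countF (Xs i) ≤ countF Y
    stop       : ∀ Y → ¬ SmallCut G d (Hs (k ∸ 1)) Y
open Run public

removed : ∀ {m} {G : Graph m} {d : ℕ} → Run G d → ℕ
removed {G = G} r = sumF λ u → countF λ v → (part r u <ᵇ part r v) ∧ adj G u v

module Submission where

-- Let K be the number of steps and R the number of edges joining different parts.  A removed edge
-- uv with u in an earlier part X_i than v lies in δ(X_i), and 4|δ(X_i)| < d for each of the K - 1
-- cutting steps, so 4R + (K - 1) ≤ (K - 1)d.  On the other hand every part P is nonempty, and the d
-- neighbours of any u ∈ P lie in P ∖ {u} or across removed edges at P, so |P| plus the number of
-- removed edges at P is at least d + 1; summing over the K parts counts every vertex once and every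
-- removed edge twice, so K(d + 1) ≤ 2n + 2R.  Eliminating R gives Kd ≤ 4n and R ≤ n.

open import Defs hiding (sym)
open import Data.Bool using (Bool; true; false; not; _∧_; if_then_else_; T)
open import Data.Bool.Properties using (∧-zeroʳ; T-≡)
open import Data.Empty using (⊥-elim)
open import Data.Fin using (Fin; zero; suc; toℕ; fromℕ<)
open import Data.Fin.Properties using (toℕ<n; toℕ-fromℕ<)
open import Data.Nat
open import Data.Nat.Properties
open import Data.Nat.Tactic.RingSolver using (solve-∀)
open import Data.Product using (∃; _×_; _,_; proj₂)
open import Data.Vec.Functional using (removeAt)
open import Function using (_∘_; Equivalence)
open import Relation.Binary.Definitions using (tri<; tri≈; tri>)
open import Relation.Binary.PropositionalEquality
open import Relation.Nullary using (yes; no)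
open import Algebra.Properties.CommutativeMonoid.Sum +-0-commutativeMonoid
  using (sum; sum-cong-≗; ∑-distrib-+; ∑-comm; sum-remove)
open import Algebra.Properties.Semiring.Sum +-*-semiring using (*-distribˡ-sum)

indicator : Bool → ℕ
indicator b = if b then 1 else 0

T⇒≡true : ∀ {b} → T b → b ≡ true
T⇒≡true = Equivalence.to T-≡

≡true⇒T : ∀ {b} → b ≡ true → T b
≡true⇒T = Equivalence.from T-≡

∧-≡trueˡ : ∀ a {b} → a ∧ b ≡ true → a ≡ true
∧-≡trueˡ true _ = refl

≡ᵇ-refl : ∀ n → (n ≡ᵇ n) ≡ true
≡ᵇ-refl n = T⇒≡true (≡⇒≡ᵇ n n refl)

≢⇒≡ᵇ-false : ∀ {x y} → x ≢ y → (x ≡ᵇ y) ≡ false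
≢⇒≡ᵇ-false {x} {y} x≢y with x ≡ᵇ y in eq
... | true  = ⊥-elim (x≢y (≡ᵇ⇒≡ x y (≡true⇒T eq)))
... | false = refl

sumF≡sum : ∀ {m} (f : Fin m → ℕ) → sumF f ≡ sum f
sumF≡sum {zero}  f = refl
sumF≡sum {suc m} f = cong (f zero +_) (sumF≡sum (f ∘ suc))

sumF-cong : ∀ {m} {f g : Fin m → ℕ} → (∀ i → f i ≡ g i) → sumF f ≡ sumF g
sumF-cong {f = f} {g} f≗g = trans (sumF≡sum f) (trans (sum-cong-≗ f≗g) (sym (sumF≡sum g)))

sumF-+ : ∀ {m} (f g : Fin m → ℕ) → sumF (λ i → f i + g i) ≡ sumF f + sumF g
sumF-+ f g = begin
  sumF (λ i → f i + g i) ≡⟨ sumF≡sum (λ i → f i + g i) ⟩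
  sum (λ i → f i + g i)  ≡⟨ ∑-distrib-+ f g ⟩
  sum f + sum g          ≡⟨ sym (cong₂ _+_ (sumF≡sum f) (sumF≡sum g)) ⟩
  sumF f + sumF g        ∎
  where open ≡-Reasoning

sumF-comm : ∀ {m l} (f : Fin m → Fin l → ℕ) →
            sumF (λ u → sumF (f u)) ≡ sumF (λ v → sumF (λ u → f u v))
sumF-comm f = begin
  sumF (λ u → sumF (f u))          ≡⟨ sumF-cong (λ u → sumF≡sum (f u)) ⟩
  sumF (λ u → sum (f u))           ≡⟨ sumF≡sum (λ u → sum (f u)) ⟩
  sum (λ u → sum (f u))            ≡⟨ ∑-comm f ⟩
  sum (λ v → sum (λ u → f u v))    ≡⟨ sym (sumF≡sum (λ v → sum (λ u → f u v))) ⟩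
  sumF (λ v → sum (λ u → f u v))   ≡⟨ sumF-cong (λ v → sym (sumF≡sum (λ u → f u v))) ⟩
  sumF (λ v → sumF (λ u → f u v))  ∎
  where open ≡-Reasoning

sumF-*ˡ : ∀ {m} c (f : Fin m → ℕ) → sumF (λ i → c * f i) ≡ c * sumF f
sumF-*ˡ c f = begin
  sumF (λ i → c * f i) ≡⟨ sumF≡sum (λ i → c * f i) ⟩
  sum (λ i → c * f i)  ≡⟨ sym (*-distribˡ-sum c f) ⟩
  c * sum f            ≡⟨ cong (c *_) (sym (sumF≡sum f)) ⟩
  c * sumF f           ∎
  where open ≡-Reasoning

sumF-const : ∀ {m} c → sumF {m} (λ _ → c) ≡ m * c
sumF-const {zero}  c = refl
sumF-const {suc m} c = cong (c +_) (sumF-const {m} c)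

sumF-1 : ∀ {m} → sumF {m} (λ _ → 1) ≡ m
sumF-1 {m} = trans (sumF-const {m} 1) (*-identityʳ m)

sumF-mono : ∀ {m} {f g : Fin m → ℕ} → (∀ i → f i ≤ g i) → sumF f ≤ sumF g
sumF-mono {zero}  f≤g = z≤n
sumF-mono {suc m} f≤g = +-mono-≤ (f≤g zero) (sumF-mono (f≤g ∘ suc))

term≤sumF : ∀ {m} (f : Fin m → ℕ) i → f i ≤ sumF f
term≤sumF {suc m} f i = begin
  f i                        ≤⟨ m≤m+n (f i) _ ⟩
  f i + sum (removeAt f i)   ≡⟨ sym (trans (sumF≡sum f) (sum-remove f)) ⟩
  sumF f                     ∎
  where open ≤-Reasoning

indicator-mono : ∀ {a b} → (a ≡ true → b ≡ true) → indicator a ≤ indicator b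
indicator-mono {false} _   = z≤n
indicator-mono {true}  a⇒b rewrite a⇒b refl = ≤-refl

countF-mono : ∀ {m} {Q P : VSet m} → Q ⊆V P → countF Q ≤ countF P
countF-mono Q⊆P = sumF-mono (λ v → indicator-mono (Q⊆P v))

countF-mono-< : ∀ {m} {Q P : VSet m} {u} → Q ⊆V P → P u ≡ true → Q u ≡ false →
                suc (countF Q) ≤ countF P
countF-mono-< {u = zero} Q⊆P Pu Qu rewrite Pu | Qu = s≤s (countF-mono (Q⊆P ∘ suc))
countF-mono-< {Q = Q} {u = suc u} Q⊆P Pu Qu = begin
  suc (countF Q)                                 ≡⟨ sym (+-suc (indicator (Q zero)) _) ⟩
  indicator (Q zero) + suc (countF (Q ∘ suc))    ≤⟨ +-mono-≤ (indicator-mono (Q⊆P zero))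
                                                             (countF-mono-< (Q⊆P ∘ suc) Pu Qu) ⟩
  _                                              ∎
  where open ≤-Reasoning

countF-split : ∀ {m} (b a : VSet m) →
               countF a ≡ countF (λ v → b v ∧ a v) + countF (λ v → not (b v) ∧ a v)
countF-split b a = trans (sumF-cong split)
                          (sumF-+ (λ v → indicator (b v ∧ a v)) (λ v → indicator (not (b v) ∧ a v)))
  where
  split : ∀ v → indicator (a v) ≡ indicator (b v ∧ a v) + indicator (not (b v) ∧ a v)
  split v with b v
  ... | true  = sym (+-identityʳ _)
  ... | false = refl

sumF-restrict : ∀ {m} (X : VSet m) (f : Fin m → ℕ) {u} → X u ≡ true →
                f u ≤ sumF (λ v → if X v then f v else 0)
sumF-restrict X f {u} Xu =
  subst (_≤ sumF restricted) (cong (λ b → if b then f u else 0) Xu) (term≤sumF restricted u)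
  where
  restricted : Fin _ → ℕ
  restricted v = if X v then f v else 0

sumF-singleton≤ : ∀ {K} p x → sumF {K} (λ i → if p ≡ᵇ toℕ i then x else 0) ≤ x
sumF-singleton≤ {zero}  p       x = z≤n
sumF-singleton≤ {suc K} zero    x = ≤-reflexive (begin
  x + sumF {K} (λ _ → 0) ≡⟨ cong (x +_) (trans (sumF-const {K} 0) (*-zeroʳ K)) ⟩
  x + 0                  ≡⟨ +-identityʳ x ⟩
  x                      ∎)
  where open ≡-Reasoning
sumF-singleton≤ {suc K} (suc p) x = sumF-singleton≤ {K} p x

sumF-partition : ∀ {m} K (p : Fin m → ℕ) (f : Fin m → ℕ) →
                 sumF {K} (λ i → sumF (λ u → if p u ≡ᵇ toℕ i then f u else 0)) ≤ sumF f
sumF-partition {m} K p f = begin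
  sumF {K} (λ i → sumF (λ u → if p u ≡ᵇ toℕ i then f u else 0)) ≡⟨ sumF-comm {K} {m} _ ⟩
  sumF (λ u → sumF {K} (λ i → if p u ≡ᵇ toℕ i then f u else 0)) ≤⟨ sumF-mono singleton ⟩
  sumF f                                                         ∎
  where
  open ≤-Reasoning
  singleton : ∀ u → sumF {K} (λ i → if p u ≡ᵇ toℕ i then f u else 0) ≤ f u
  singleton u = sumF-singleton≤ {K} (p u) (f u)

counting-arith : ∀ n d K R → 1 ≤ K → 4 * R + (K ∸ 1) ≤ (K ∸ 1) * d →
                 K * suc d ≤ 2 * n + 2 * R → K * d ≤ 4 * n × R ≤ n
counting-arith n d (suc K) R _ cuts parts = Kd≤4n , R≤n
  where
  open ≤-Reasoning
  expand : ∀ K d → suc K * d + K * d + (2 + d + 3 * K) ≡ 2 * (suc K * suc d) + K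
  expand = solve-∀
  regroup : ∀ n R K → 2 * (2 * n + 2 * R) + K ≡ 4 * n + (4 * R + K)
  regroup = solve-∀
  Kd≤4n : suc K * d ≤ 4 * n
  Kd≤4n = +-cancelʳ-≤ (K * d) _ _ (begin
    suc K * d + K * d                    ≤⟨ m≤m+n _ (2 + d + 3 * K) ⟩
    suc K * d + K * d + (2 + d + 3 * K)  ≡⟨ expand K d ⟩
    2 * (suc K * suc d) + K              ≤⟨ +-monoˡ-≤ K (*-monoʳ-≤ 2 parts) ⟩
    2 * (2 * n + 2 * R) + K              ≡⟨ regroup n R K ⟩
    4 * n + (4 * R + K)                  ≤⟨ +-monoʳ-≤ (4 * n) cuts ⟩
    4 * n + K * d                        ∎)
  R≤n : R ≤ n
  R≤n = *-cancelˡ-≤ 4 (begin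
    4 * R      ≤⟨ m≤m+n (4 * R) K ⟩
    4 * R + K  ≤⟨ cuts ⟩
    K * d      ≤⟨ m≤n+m (K * d) d ⟩
    suc K * d  ≤⟨ Kd≤4n ⟩
    4 * n      ∎)

module _ {m} {G : Graph m} {d : ℕ} (r : Run G d) where

  crossing : Fin m → Fin m → ℕ
  crossing u v = indicator ((part r u <ᵇ part r v) ∧ adj G u v)

  crossDegree : Fin m → ℕ
  crossDegree u = countF λ v → not (Xs r (part r u) v) ∧ adj G u v

  partWeight : ℕ → ℕ
  partWeight i = sumF λ u → if Xs r i u then suc (crossDegree u) else 0

  cutTerm : ℕ → Fin m → Fin m → ℕ
  cutTerm i u v = indicator (Xs r i u ∧ Hs r i v ∧ not (Xs r i v) ∧ adj G u v)

  self∈part : ∀ u → Xs r (part r u) u ≡ true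
  self∈part u = ≡ᵇ-refl (part r u)

  crossing-between : ∀ u v → indicator (not (Xs r (part r u) v) ∧ adj G u v) ≤
                             crossing u v + crossing v u
  crossing-between u v rewrite Graph.sym G v u
    with part r v ≡ᵇ part r u in same | <-cmp (part r u) (part r v)
  ... | true  | _            = z≤n
  ... | false | tri< u<v _ _ rewrite T⇒≡true (<⇒<ᵇ u<v) = m≤m+n _ _
  ... | false | tri≈ _ u≡v _ = ⊥-elim (subst T same (≡⇒≡ᵇ _ _ (sym u≡v)))
  ... | false | tri> _ _ v<u rewrite T⇒≡true (<⇒<ᵇ v<u) = m≤n+m _ _

  sumF-crossDegree : sumF crossDegree ≤ 2 * removed r
  sumF-crossDegree = begin
    sumF crossDegree
      ≤⟨ sumF-mono (λ u → sumF-mono (crossing-between u)) ⟩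
    sumF (λ u → sumF (λ v → crossing u v + crossing v u))
      ≡⟨ sumF-cong (λ u → sumF-+ (crossing u) (λ v → crossing v u)) ⟩
    sumF (λ u → sumF (crossing u) + sumF (λ v → crossing v u))
      ≡⟨ sumF-+ (λ u → sumF (crossing u)) (λ u → sumF (λ v → crossing v u)) ⟩
    removed r + sumF (λ u → sumF (λ v → crossing v u))
      ≡⟨ cong (removed r +_) (sym (sumF-comm crossing)) ⟩
    removed r + removed r
      ≡⟨ cong (removed r +_) (sym (+-identityʳ _)) ⟩
    2 * removed r
      ∎
    where open ≤-Reasoning

  last-part-nonempty : Fin m → ∀ i → k r ≡ suc i → ∃ λ u → part r u ≡ i
  last-part-nonempty v₀ zero k≡1 =
    v₀ , n<1⇒n≡0 (subst (part r v₀ <_) k≡1 (part<k r v₀))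
  last-part-nonempty v₀ (suc i) k≡2+i
    with step-small r i (subst (suc i <_) (sym k≡2+i) ≤-refl)
  ... | (_ , _ , (v , v∈H , v∉X)) , _ = v , ≤-antisym (s≤s⁻¹ v<2+i) i<v
    where
    v<2+i : part r v < suc (suc i)
    v<2+i = subst (part r v <_) k≡2+i (part<k r v)
    i<v : i < part r v
    i<v = ≤∧≢⇒< (≤ᵇ⇒≤ i (part r v) (≡true⇒T v∈H))
                (λ i≡v → subst T v∉X (≡⇒≡ᵇ _ _ (sym i≡v)))

  part-nonempty : Fin m → ∀ i → i < k r → ∃ λ u → part r u ≡ i
  part-nonempty v₀ i i<k with suc i <? k r
  ... | yes 1+i<k = let ((_ , (u , u∈X) , _) , _) = step-small r i 1+i<k
                    in u , ≡ᵇ⇒≡ _ _ (≡true⇒T u∈X)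
  ... | no  1+i≮k = last-part-nonempty v₀ i (≤-antisym (≮⇒≥ 1+i≮k) i<k)

  part-weight : Regular G d → ∀ u → suc d ≤ partWeight (part r u)
  part-weight reg u = begin
    suc d
      ≡⟨ cong suc (sym (reg u)) ⟩
    suc (degree G u)
      ≡⟨ cong suc (countF-split X (adj G u)) ⟩
    suc (countF (λ v → X v ∧ adj G u v)) + crossDegree u
      ≤⟨ +-monoˡ-≤ (crossDegree u) inner<part ⟩
    countF X + crossDegree u
      ≤⟨ +-monoʳ-≤ (countF X) (sumF-restrict X crossDegree (self∈part u)) ⟩
    countF X + sumF (λ v → if X v then crossDegree v else 0)
      ≡⟨ sym (sumF-+ (λ v → indicator (X v)) (λ v → if X v then crossDegree v else 0)) ⟩
    sumF (λ v → indicator (X v) + (if X v then crossDegree v else 0))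
      ≡⟨ sumF-cong (λ v → indicator+if (X v)) ⟩
    partWeight (part r u)
      ∎
    where
    open ≤-Reasoning
    X : VSet m
    X = Xs r (part r u)
    inner<part : suc (countF (λ v → X v ∧ adj G u v)) ≤ countF X
    inner<part = countF-mono-< (λ v → ∧-≡trueˡ (X v)) (self∈part u)
                               (trans (cong (X u ∧_) (irrefl G u)) (∧-zeroʳ (X u)))
    indicator+if : ∀ b {x} → indicator b + (if b then x else 0) ≡ (if b then suc x else 0)
    indicator+if true  = refl
    indicator+if false = refl

  parts-bound : Regular G d → Fin m → k r * suc d ≤ m + 2 * removed r
  parts-bound reg v₀ = begin
    k r * suc d
      ≡⟨ sym (sumF-const {k r} (suc d)) ⟩
    sumF {k r} (λ _ → suc d)
      ≤⟨ sumF-mono every-part-weighs ⟩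
    sumF {k r} (partWeight ∘ toℕ)
      ≤⟨ sumF-partition (k r) (part r) (suc ∘ crossDegree) ⟩
    sumF (λ u → 1 + crossDegree u)
      ≡⟨ sumF-+ (λ _ → 1) crossDegree ⟩
    sumF {m} (λ _ → 1) + sumF crossDegree
      ≤⟨ +-mono-≤ (≤-reflexive (sumF-1 {m})) sumF-crossDegree ⟩
    m + 2 * removed r
      ∎
    where
    open ≤-Reasoning
    every-part-weighs : ∀ i → suc d ≤ partWeight (toℕ i)
    every-part-weighs i with part-nonempty v₀ (toℕ i) (toℕ<n i)
    ... | u , u∈i = subst (λ j → suc d ≤ partWeight j) u∈i (part-weight reg u)

  cutSteps : ℕ
  cutSteps = k r ∸ 1

  stageCut : Fin cutSteps → ℕ
  stageCut i = cut G (Hs r (toℕ i)) (Xs r (toℕ i))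

  crossing≤cuts : ∀ u v → crossing u v ≤ sumF {cutSteps} (λ i → cutTerm (toℕ i) u v)
  crossing≤cuts u v with part r u <ᵇ part r v in u<ᵇv
  ... | false = z≤n
  ... | true  = begin
    indicator (adj G u v)
      ≡⟨ cutTerm-at-part ⟩
    cutTerm (part r u) u v
      ≡⟨ cong (λ i → cutTerm i u v) (sym (toℕ-fromℕ< u<k-1)) ⟩
    cutTerm (toℕ (fromℕ< u<k-1)) u v
      ≤⟨ term≤sumF (λ i → cutTerm (toℕ i) u v) (fromℕ< u<k-1) ⟩
    sumF {cutSteps} (λ i → cutTerm (toℕ i) u v)
      ∎
    where
    open ≤-Reasoning
    u<v : part r u < part r v
    u<v = <ᵇ⇒< _ _ (≡true⇒T u<ᵇv)
    u<k-1 : part r u < k r ∸ 1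
    u<k-1 = <-≤-trans u<v (<⇒≤pred (part<k r v))
    cutTerm-at-part : indicator (adj G u v) ≡ cutTerm (part r u) u v
    cutTerm-at-part
      rewrite self∈part u | T⇒≡true (≤⇒≤ᵇ (<⇒≤ u<v)) | ≢⇒≡ᵇ-false (>⇒≢ u<v) = refl

  removed≤cuts : removed r ≤ sumF stageCut
  removed≤cuts = begin
    removed r
      ≤⟨ sumF-mono (λ u → sumF-mono (crossing≤cuts u)) ⟩
    sumF (λ u → sumF (λ v → sumF {cutSteps} (λ i → cutTerm (toℕ i) u v)))
      ≡⟨ sumF-cong (λ u → sumF-comm {m} {cutSteps} (λ v i → cutTerm (toℕ i) u v)) ⟩
    sumF (λ u → sumF {cutSteps} (λ i → sumF (cutTerm (toℕ i) u)))
      ≡⟨ sumF-comm {m} {cutSteps} (λ u i → sumF (cutTerm (toℕ i) u)) ⟩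
    sumF stageCut
      ∎
    where open ≤-Reasoning

  cuts-bound : 4 * removed r + cutSteps ≤ cutSteps * d
  cuts-bound = begin
    4 * removed r + cutSteps
      ≤⟨ +-monoˡ-≤ cutSteps (*-monoʳ-≤ 4 removed≤cuts) ⟩
    4 * sumF stageCut + cutSteps
      ≡⟨ +-comm (4 * sumF stageCut) cutSteps ⟩
    cutSteps + 4 * sumF stageCut
      ≡⟨ sym (cong₂ _+_ (sumF-1 {cutSteps}) (sumF-*ˡ 4 stageCut)) ⟩
    sumF {cutSteps} (λ _ → 1) + sumF (λ i → 4 * stageCut i)
      ≡⟨ sym (sumF-+ (λ _ → 1) (λ i → 4 * stageCut i)) ⟩
    sumF (λ i → suc (4 * stageCut i))
      ≤⟨ sumF-mono small-cut ⟩
    sumF {cutSteps} (λ _ → d)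
      ≡⟨ sumF-const {cutSteps} d ⟩
    cutSteps * d
      ∎
    where
    open ≤-Reasoning
    small-cut : ∀ i → suc (4 * stageCut i) ≤ d
    small-cut i = proj₂ (step-small r (toℕ i) (pred-cancel-< (toℕ<n i)))

lemma5p5 : (n d : ℕ) → 1 ≤ n → 1 ≤ d → (G : Graph (2 * n)) → Regular G d → Bipartite G →
             (r : Run G d) → (k r * d ≤ 4 * n) × (removed r ≤ n)
lemma5p5 (suc n) d _ _ G reg _ r =
  counting-arith (suc n) d (k r) (removed r) (k≥1 r) (cuts-bound r) (parts-bound r reg zero)
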